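{- Let $n\ge1$, let $\pi\in\mathfrak{S}_n$, and write $\pi=\sigma_1+\sigma_2+\cdots+\sigma_m$ as its (unique) sum of indecomposable permutations. Let $w$ be the word $\sigma_1\sigma_2\cdots\sigma_m$ whose letters are the permutations $\sigma_i$ (two letters being equal iff they are equal permutations). Then $M^{(W_n)}(x)_{D_\pi,D_\pi}=F_w(x)$.
   Context: For integers $a\le b$, $[a,b]=\{a,\ldots,b\}$. For $\alpha\in\mathfrak{S}_\ell$, $\beta\in\mathfrak{S}_{n-\ell}$, the sum $\pi=\alpha+\beta\in\mathfrak{S}_n$ is given by $\pi_i=\alpha_i$ for $i\le\ell$ and $\pi_i=\ell+\beta_{i-\ell}$ for $i>\ell$. A permutation is decomposable if it is a sum of two permutations of smaller (positive) length, and indecomposable otherwise. For a word $w=w_1\cdots w_m$ and $k\ge1$, let $f_w(k)$ be the number of surjections $c:[1,m]\to[1,k]$ such that concatenating, for $i=1,2,\ldots,k$ in order, the subwords of $w$ formed by the letters in positions $c^{ -1}(i)$ (taken in increasing order of position) yields $w$ again (i.e. the number of ways to read $w$ from left to right in $k$ passes, each pass reading at least one not-yet-read letter, so that the concatenated readings reproduce $w$). Let $F_w(x)=\sum_{k\ge1}f_w(k)x^k$. Web diagrams: a web diagram on $p$ pegs with $m$ edges is a set $D=\{e_j=(a_j,b_j,c_j,d_j)\}$ of 4-tuples (edge $e_j$ joins peg $a_j$ at height $c_j$ to peg $b_j$ at height $d_j$, $a_j<b_j$), where on each peg the heights of the incident edge endpoints are exactly $1,\ldots,$(number of incident endpoints),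 each used once. The sum $D\oplus D'$ places $D'$ on top of $D$: $D\oplus D'=D\cup\{(x',y',a'+p_{x'}(D),b'+p_{y'}(D)):(x',y',a',b')\in D'\}$, where $p_i(D)$ is the number of edge endpoints of $D$ on peg $i$. $W_n$ is the web world of diagrams on two pegs with $n$ edges all joining peg $1$ to peg $2$; its elements are exactly $D_\pi=\{(1,2,i,\pi_i):1\le i\le n\}$ for $\pi\in\mathfrak{S}_n$. An $\ell$-colouring of $D$ is a surjection $\alpha$ from the edges of $D$ onto $[1,\ell]$; $D_\alpha(i)$ is the set of edges of colour $i$; $\mathrm{rel}$ relabels heights on each peg by $1,2,\ldots$ preserving order; the reconstruction is $\alpha(D)=\mathrm{rel}(D_\alpha(1))\oplus\cdots\oplus\mathrm{rel}(D_\alpha(\ell))$. The web-colouring matrix has entries $M^{(W_n)}(x)_{D,D'}=\sum_{\ell\ge1}x^\ell f(D,D',\ell)$, where $f(D,D',\ell)$ is the number of $\ell$-colourings $\alpha$ of $D$ with $\alpha(D)=D'$. -}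

module Defs where

open import Data.Nat using (ℕ; zero; suc; _+_; _<_; _≤_; _<?_)
import Data.Nat.Properties as ℕP
open import Data.Fin using (Fin)
import Data.Fin.Properties as FinP
open import Data.List using (List; []; _∷_; _++_; map; concat; concatMap; length; filter; zip; foldr; foldl; upTo; allFin)
import Data.List.Properties as ListP
open import Data.List.Relation.Binary.Permutation.Propositional using (_↭_)
open import Data.List.Relation.Unary.All using (All; all?)
open import Data.Vec using (Vec; []; _∷_; toList)
open import Data.Product using (Σ; ∃; ∃-syntax; _×_; _,_; proj₁; proj₂)
import Data.Product.Properties as ×P
open import Data.Empty using (⊥)
open import Relation.Nullary using (¬_; Dec; yes; no)
open import Relation.Nullary.Decidable using (_×-dec_)
open import Relation.Unary using (Decidable)
open import Relation.Binary.PropositionalEquality using (_≡_; refl)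
open import Relation.Binary.Definitions using (DecidableEquality)

-- Generic finite counting: functions [1,m] → [1,k] are represented as
-- vectors c ∈ Vec (Fin k) m (position i ↦ c_i); we enumerate them all.

allVecs : (m k : ℕ) → List (Vec (Fin k) m)
allVecs zero    k = [] ∷ []
allVecs (suc m) k = concatMap (λ i → map (i ∷_) (allVecs m k)) (allFin k)

count : ∀ {m k} (P : Vec (Fin k) m → Set) → Decidable P → ℕ
count {m} {k} P P? = length (filter P? (allVecs m k))

Surjective : ∀ {m k} → Vec (Fin k) m → Set
Surjective {m} {k} c = (j : Fin k) → ∃[ i ] (Data.Vec.lookup c i ≡ j)

surjective? : ∀ {m k} → Decidable (Surjective {m} {k})
surjective? c = FinP.all? (λ j → FinP.any? (λ i → Data.Vec.lookup c i FinP.≟ j))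

classOf : ∀ {A : Set} {k} (xs : List A) → Vec (Fin k) (length xs) → Fin k → List A
classOf xs c j = map proj₂ (filter (λ p → proj₁ p FinP.≟ j) (zip (toList c) xs))

-- Permutations in one-line notation (values 1..n), sums, (in)decomposability

IsPerm : ℕ → List ℕ → Set
IsPerm n p = p ↭ map suc (upTo n)

_⊞_ : List ℕ → List ℕ → List ℕ
α ⊞ β = α ++ map (length α +_) β

Decomposable : List ℕ → Set
Decomposable π = ∃[ α ] ∃[ β ]
  (IsPerm (length α) α × IsPerm (length β) β ×
   1 ≤ length α × 1 ≤ length β × π ≡ α ⊞ β)

Indecomposable : List ℕ → Set
Indecomposable σ = IsPerm (length σ) σ × 1 ≤ length σ × ¬ Decomposable σ

sumPerms : List (List ℕ) → List ℕ
sumPerms = foldr _⊞_ []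

readIn : ∀ {A : Set} {k} (w : List A) → Vec (Fin k) (length w) → List A
readIn {k = k} w c = concat (map (classOf w c) (allFin k))

fWord : ∀ {A : Set} → DecidableEquality A → List A → ℕ → ℕ
fWord {A} _≟A_ w k =
  count {length w} {k} (λ c → Surjective c × readIn w c ≡ w)
        (λ c → surjective? c ×-dec ListP.≡-dec _≟A_ (readIn w c) w)

-- coefficients of F_w(x) = Σ_{k≥1} f_w(k) x^k
FWord : ∀ {A : Set} → DecidableEquality A → List A → ℕ → ℕ
FWord _≟A_ w zero    = 0
FWord _≟A_ w (suc k) = fWord _≟A_ w (suc k)

-- Web diagrams: an edge (a , b , c , d) joins peg a at height c to peg b
-- at height d; a diagram is a finite set of edges, given as a list.

Edge : Set
Edge = ℕ × ℕ × ℕ × ℕ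

Diagram : Set
Diagram = List Edge

_≟E_ : DecidableEquality Edge
_≟E_ = ×P.≡-dec ℕP._≟_ (×P.≡-dec ℕP._≟_ (×P.≡-dec ℕP._≟_ ℕP._≟_))

endpoints : Diagram → List (ℕ × ℕ)
endpoints = concatMap (λ { (a , b , c , d) → (a , c) ∷ (b , d) ∷ [] })

pegCount : ℕ → Diagram → ℕ
pegCount i D = length (filter (λ e → proj₁ e ℕP.≟ i) (endpoints D))

_⊕_ : Diagram → Diagram → Diagram
D ⊕ D' = D ++ map (λ { (x , y , a , b) → (x , y , a + pegCount x D , b + pegCount y D) }) D'

rank : ℕ → ℕ → Diagram → ℕ
rank p h D = suc (length (filter (λ e → (proj₁ e ℕP.≟ p) ×-dec (proj₂ e <? h)) (endpoints D)))

rel : Diagram → Diagram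
rel D = map (λ { (a , b , c , d) → (a , b , rank a c D , rank b d D) }) D

reconstruct : ∀ {ℓ} (D : Diagram) → Vec (Fin ℓ) (length D) → Diagram
reconstruct {ℓ} D α = foldl _⊕_ [] (map (λ i → rel (classOf D α i)) (allFin ℓ))

SameDiagram : Diagram → Diagram → Set
SameDiagram D D' = All (λ e → Data.List.Membership.Propositional._∈_ e D') D
                 × All (λ e → Data.List.Membership.Propositional._∈_ e D) D'
  where import Data.List.Membership.Propositional

sameDiagram? : (D D' : Diagram) → Dec (SameDiagram D D')
sameDiagram? D D' = all? (λ e → e ∈? D') D ×-dec all? (λ e → e ∈? D) D'
  where open import Data.List.Membership.DecPropositional _≟E_ using (_∈?_)

fWeb : Diagram → Diagram → ℕ → ℕ
fWeb D D' ℓ =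
  count {length D} {ℓ} (λ α → Surjective α × SameDiagram (reconstruct D α) D')
        (λ α → surjective? α ×-dec sameDiagram? (reconstruct D α) D')

-- coefficients of M(x)_{D,D'} = Σ_{ℓ≥1} x^ℓ f(D, D', ℓ)
webEntry : Diagram → Diagram → ℕ → ℕ
webEntry D D' zero    = 0
webEntry D D' (suc ℓ) = fWeb D D' (suc ℓ)

Dperm : List ℕ → Diagram
Dperm π = map (λ { (i , πi) → (1 , 2 , i , πi) }) (zip (map suc (upTo (length π))) π)

_≟L_ : DecidableEquality (List ℕ)
_≟L_ = ListP.≡-dec ℕP._≟_

-- An ℓ-colouring of D_π reconstructs D_π exactly when the standardised colour classes of π,
-- added up in colour order, give π back. Counting cuts shows that such a sum has as many
-- components as its summands together, and a class meeting a block contributes at least one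
-- component to it; as π = σ₁ + ⋯ + σₘ has exactly m components, a reconstructing colouring
-- is constant on every block σᵢ. Block-constant colourings are the colourings of the word
-- σ₁ ⋯ σₘ, and for them the reconstruction condition says that the subwords, read in colour
-- order and summed, give σ₁ + ⋯ + σₘ; by uniqueness of the decomposition into indecomposables,
-- that is exactly the condition that reading the word in these passes reproduces it.

module Submission where

open import Defs
open import Data.Nat using (ℕ; zero; suc; _+_; _∸_; _<_; _≤_; _<?_; _≤?_; _<ᵇ_; z≤n; s≤s)
open import Data.Bool using (true; false)
import Data.Nat.Properties as ℕP
open import Algebra.Properties.CommutativeSemigroup ℕP.+-commutativeSemigroup using () renaming (interchange to +-interchange)
open import Data.Nat.ListAction using (sum)
open import Data.Fin using (Fin)
import Data.Fin.Properties as FinP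
open import Data.List using (List; []; _∷_; _++_; map; concat; concatMap; length; filter; zip; foldl; replicate; take; drop; upTo; applyUpTo; allFin)
import Data.List.Properties as ListP
open import Data.List.Membership.Propositional using (_∈_; find; lose)
open import Data.List.Membership.Propositional.Properties
open import Data.List.Relation.Binary.Subset.Propositional using (_⊆_)
open import Data.List.Relation.Unary.Any using (here; there)
import Data.List.Relation.Unary.Any as Any
open import Data.List.Relation.Unary.All using (All; []; _∷_)
import Data.List.Relation.Unary.All as All
import Data.List.Relation.Unary.All.Properties as AllP
open import Data.List.Relation.Unary.AllPairs using (AllPairs; []; _∷_)
open import Data.List.Relation.Unary.Unique.Propositional using (Unique)
import Data.List.Relation.Unary.Unique.Propositional.Properties as UniqueP
open import Data.List.Relation.Binary.Permutation.Propositional using (_↭_)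
import Data.List.Relation.Binary.Permutation.Propositional.Properties as PermP
open import Data.Vec using (Vec; []; _∷_; toList; fromList; cast)
import Data.Vec.Properties as VecP
import Data.Vec.Membership.Propositional.Properties as VecM
import Data.Vec.Relation.Unary.Any as VecAny
import Data.Vec.Relation.Unary.Any.Properties as VecAnyP
open import Data.Product using (_,_; _×_; proj₁; proj₂; ∃-syntax)
open import Data.Sum using (inj₁; inj₂)
open import Data.Empty using (⊥; ⊥-elim)
open import Relation.Nullary using (¬_; yes; no)
open import Relation.Binary.Definitions using (tri<; tri≈; tri>)
open import Relation.Nullary.Decidable using (_×-dec_)
open import Relation.Unary using (Decidable)
open import Relation.Binary.PropositionalEquality
open import Function using (_∘_)

module _ {A B : Set} {P : A → Set} {Q : B → Set} (P? : Decidable P) (Q? : Decidable Q) where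

  length-filter-map : ∀ (f : B → A) xs → All (λ x → (P (f x) → Q x) × (Q x → P (f x))) xs →
    length (filter P? (map f xs)) ≡ length (filter Q? xs)
  length-filter-map f [] [] = refl
  length-filter-map f (x ∷ xs) ((p⇒q , q⇒p) ∷ rest) with P? (f x) | Q? x
  ... | yes p | yes q = cong suc (length-filter-map f xs rest)
  ... | yes p | no ¬q = ⊥-elim (¬q (p⇒q p))
  ... | no ¬p | yes q = ⊥-elim (¬p (q⇒p q))
  ... | no ¬p | no ¬q = length-filter-map f xs rest

length-filter-cong : ∀ {A : Set} {P Q : A → Set} (P? : Decidable P) (Q? : Decidable Q) xs →
  All (λ x → (P x → Q x) × (Q x → P x)) xs → length (filter P? xs) ≡ length (filter Q? xs)
length-filter-cong P? Q? xs h =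
  trans (cong (λ ys → length (filter P? ys)) (sym (ListP.map-id xs))) (length-filter-map P? Q? (λ x → x) xs h)

length-filter-++ : ∀ {A : Set} {P : A → Set} (P? : Decidable P) xs ys →
  length (filter P? (xs ++ ys)) ≡ length (filter P? xs) + length (filter P? ys)
length-filter-++ P? xs ys = trans (cong length (ListP.filter-++ P? xs ys)) (ListP.length-++ (filter P? xs))

module _ {A : Set} (f : A → ℕ) where

  sum-map-+ : ∀ (g : A → ℕ) xs → sum (map (λ x → f x + g x) xs) ≡ sum (map f xs) + sum (map g xs)
  sum-map-+ g [] = refl
  sum-map-+ g (x ∷ xs) = begin
    f x + g x + sum (map (λ x → f x + g x) xs)           ≡⟨ cong (f x + g x +_) (sum-map-+ g xs) ⟩
    f x + g x + (sum (map f xs) + sum (map g xs))        ≡⟨ +-interchange (f x) (g x) _ _ ⟩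
    f x + sum (map f xs) + (g x + sum (map g xs))        ∎
    where open ≡-Reasoning

  ∈⇒≤sum-map : ∀ {x xs} → x ∈ xs → f x ≤ sum (map f xs)
  ∈⇒≤sum-map {xs = y ∷ xs} (here refl) = ℕP.m≤m+n (f y) _
  ∈⇒≤sum-map {xs = y ∷ xs} (there x∈) = ℕP.≤-trans (∈⇒≤sum-map x∈) (ℕP.m≤n+m _ (f y))

  ∈-≢⇒+≤sum-map : ∀ {x y xs} → Unique xs → x ∈ xs → y ∈ xs → ¬ x ≡ y → f x + f y ≤ sum (map f xs)
  ∈-≢⇒+≤sum-map _ (here refl) (here refl) x≢y = ⊥-elim (x≢y refl)
  ∈-≢⇒+≤sum-map _ (here refl) (there y∈) _ = ℕP.+-monoʳ-≤ _ (∈⇒≤sum-map y∈)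
  ∈-≢⇒+≤sum-map {x} {xs = z ∷ xs} _ (there x∈) (here refl) _ =
    subst (_≤ f z + sum (map f xs)) (ℕP.+-comm (f z) (f x)) (ℕP.+-monoʳ-≤ (f z) (∈⇒≤sum-map x∈))
  ∈-≢⇒+≤sum-map {xs = z ∷ _} (_ ∷ xs!) (there x∈) (there y∈) x≢y =
    ℕP.≤-trans (∈-≢⇒+≤sum-map xs! x∈ y∈ x≢y) (ℕP.m≤n+m _ (f z))

split-++ : ∀ {A : Set} n (xs : List A) {m} → length xs ≡ n + m →
  ∃[ ys ] ∃[ zs ] (xs ≡ ys ++ zs × length ys ≡ n × length zs ≡ m)
split-++ zero xs len≡ = [] , xs , refl , refl , len≡
split-++ (suc n) (x ∷ xs) len≡ with split-++ n xs (ℕP.suc-injective len≡)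
... | ys , zs , refl , |ys| , |zs| = x ∷ ys , zs , refl , cong suc |ys| , |zs|

+-squeeze : ∀ {a b c d} → a + b ≤ c + d → c ≤ a → d ≤ b → a ≤ c × b ≤ d
+-squeeze {a} {b} {c} {d} a+b≤c+d c≤a d≤b =
  ℕP.+-cancelʳ-≤ b a c (ℕP.≤-trans a+b≤c+d (ℕP.+-monoʳ-≤ c d≤b)) ,
  ℕP.+-cancelˡ-≤ a b d (ℕP.≤-trans a+b≤c+d (ℕP.+-monoˡ-≤ d c≤a))

replicate-++-head : ∀ {A : Set} {x y : A} {xs ys} n → 1 ≤ n → replicate n x ++ xs ≡ replicate n y ++ ys → x ≡ y
replicate-++-head (suc n) _ eq = ListP.∷-injectiveˡ eq

All≡⇒replicate : ∀ {A : Set} {x : A} {xs} → All (_≡ x) xs → xs ≡ replicate (length xs) x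
All≡⇒replicate [] = refl
All≡⇒replicate (refl ∷ xs≡) = cong (_ ∷_) (All≡⇒replicate xs≡)

take-++-≤ : ∀ {A : Set} o (xs ys : List A) → o ≤ length xs → take o (xs ++ ys) ≡ take o xs
take-++-≤ zero xs ys _ = refl
take-++-≤ (suc o) (x ∷ xs) ys (s≤s o≤) = cong (x ∷_) (take-++-≤ o xs ys o≤)

take-++-+ : ∀ {A : Set} o (xs ys : List A) → take (length xs + o) (xs ++ ys) ≡ xs ++ take o ys
take-++-+ o [] ys = refl
take-++-+ o (x ∷ xs) ys = cong (x ∷_) (take-++-+ o xs ys)

drop-++ : ∀ {A : Set} (xs ys : List A) → drop (length xs) (xs ++ ys) ≡ ys
drop-++ [] ys = refl
drop-++ (x ∷ xs) ys = drop-++ xs ys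

length-zip : ∀ {A B : Set} (xs : List A) (ys : List B) → length xs ≡ length ys → length (zip xs ys) ≡ length xs
length-zip [] [] _ = refl
length-zip (x ∷ xs) (y ∷ ys) len≡ = cong suc (length-zip xs ys (ℕP.suc-injective len≡))

zip-++ : ∀ {A B : Set} (xs xs′ : List A) (ys ys′ : List B) → length xs ≡ length ys →
  zip (xs ++ xs′) (ys ++ ys′) ≡ zip xs ys ++ zip xs′ ys′
zip-++ [] xs′ [] ys′ _ = refl
zip-++ (x ∷ xs) xs′ (y ∷ ys) ys′ len≡ = cong ((x , y) ∷_) (zip-++ xs xs′ ys ys′ (ℕP.suc-injective len≡))

Unique⇒length≤ : ∀ {A : Set} {xs ys : List A} → Unique xs → xs ⊆ ys → length xs ≤ length ys
Unique⇒length≤ {xs = []} _ _ = z≤n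
Unique⇒length≤ {xs = x ∷ xs} (x∉xs ∷ xs!) xs⊆ys with ∈-∃++ (xs⊆ys (here refl))
... | us , vs , refl = begin
  suc (length xs)           ≤⟨ s≤s (Unique⇒length≤ xs! xs⊆us++vs) ⟩
  suc (length (us ++ vs))   ≡⟨ ListP.length-++-sucʳ us x vs ⟨
  length (us ++ x ∷ vs)     ∎
  where
    open ℕP.≤-Reasoning
    xs⊆us++vs : xs ⊆ us ++ vs
    xs⊆us++vs {z} z∈xs with ∈-++⁻ us (xs⊆ys (there z∈xs))
    ... | inj₁ z∈us = ∈-++⁺ˡ z∈us
    ... | inj₂ (here refl) = ⊥-elim (All.lookup x∉xs z∈xs refl)
    ... | inj₂ (there z∈vs) = ∈-++⁺ʳ us z∈vs

∈-allVecs : ∀ {m k} (c : Vec (Fin k) m) → c ∈ allVecs m k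
∈-allVecs [] = here refl
∈-allVecs {suc m} {k} (i ∷ c) =
  ∈-concatMap⁺ (λ j → map (j ∷_) (allVecs m k)) (Any.map (λ { refl → ∈-map⁺ (i ∷_) (∈-allVecs c) }) (∈-allFin i))

allVecs-unique : ∀ m k → Unique (allVecs m k)
allVecs-unique zero k = [] ∷ []
allVecs-unique (suc m) k = prefixAll (allFin k) (UniqueP.allFin⁺ k)
  where
    L : List (Vec (Fin k) m)
    L = allVecs m k
    prefixAll : ∀ is → Unique is → Unique (concatMap (λ i → map (i ∷_) L) is)
    prefixAll [] _ = []
    prefixAll (i ∷ is) (i∉is ∷ is!) =
      UniqueP.++⁺ (UniqueP.map⁺ VecP.∷-injectiveʳ (allVecs-unique m k)) (prefixAll is is!) disjoint
      where
        disjoint : ∀ {v} → v ∈ map (i ∷_) L × v ∈ concatMap (λ i → map (i ∷_) L) is → ⊥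
        disjoint (v∈ , v∈′) with ∈-map⁻ (i ∷_) v∈
        ... | _ , _ , refl with find (∈-concatMap⁻ (λ i → map (i ∷_) L) {xs = is} v∈′)
        ... | j , j∈is , w∈ with ∈-map⁻ (j ∷_) w∈
        ... | _ , _ , refl = All.lookup i∉is j∈is refl

module _ {m n k : ℕ}
         (P : Vec (Fin k) n → Set) (P? : Decidable P)
         (Q : Vec (Fin k) m → Set) (Q? : Decidable Q)
         (e : Vec (Fin k) m → Vec (Fin k) n) (e-injective : ∀ {x y} → e x ≡ e y → x ≡ y)
         (Q⇒P : ∀ c → Q c → P (e c)) (P⇒Q : ∀ c → P c → ∃[ c′ ] (e c′ ≡ c × Q c′)) where

  private
    Ps : List (Vec (Fin k) n)
    Ps = filter P? (allVecs n k)

    Qs : List (Vec (Fin k) m)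
    Qs = filter Q? (allVecs m k)

    Ps⊆eQs : Ps ⊆ map e Qs
    Ps⊆eQs c∈ with P⇒Q _ (proj₂ (∈-filter⁻ P? {xs = allVecs n k} c∈))
    ... | c′ , refl , qc′ = ∈-map⁺ e (∈-filter⁺ Q? (∈-allVecs c′) qc′)

    eQs⊆Ps : map e Qs ⊆ Ps
    eQs⊆Ps c∈ with ∈-map⁻ e c∈
    ... | c′ , c′∈ , refl =
      ∈-filter⁺ P? (∈-allVecs (e c′)) (Q⇒P c′ (proj₂ (∈-filter⁻ Q? {xs = allVecs m k} c′∈)))

  count-reindex : count P P? ≡ count Q Q?
  count-reindex = ℕP.≤-antisym
    (subst (length Ps ≤_) (ListP.length-map e Qs)
      (Unique⇒length≤ (UniqueP.filter⁺ P? (allVecs-unique n k)) Ps⊆eQs))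
    (subst (_≤ length Ps) (ListP.length-map e Qs)
      (Unique⇒length≤ (UniqueP.map⁺ e-injective (UniqueP.filter⁺ Q? (allVecs-unique m k))) eQs⊆Ps))

range : ℕ → ℕ → List ℕ
range a zero = []
range a (suc n) = suc a ∷ range (suc a) n

map-suc-upTo : ∀ n → map suc (upTo n) ≡ range 0 n
map-suc-upTo n = map-suc-applyUpTo n 0 (λ i → i) (λ i → refl)
  where
    map-suc-applyUpTo : ∀ n a (f : ℕ → ℕ) → (∀ i → f i ≡ a + i) → map suc (applyUpTo f n) ≡ range a n
    map-suc-applyUpTo zero a f f≗ = refl
    map-suc-applyUpTo (suc n) a f f≗ = cong₂ _∷_ (cong suc (trans (f≗ 0) (ℕP.+-identityʳ a)))
      (map-suc-applyUpTo n (suc a) (λ i → f (suc i)) (λ i → trans (f≗ (suc i)) (ℕP.+-suc a i)))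

length-range : ∀ a n → length (range a n) ≡ n
length-range a zero = refl
length-range a (suc n) = cong suc (length-range (suc a) n)

range-+ : ∀ a m n → range a (m + n) ≡ range a m ++ range (a + m) n
range-+ a zero n = cong (λ b → range b n) (sym (ℕP.+-identityʳ a))
range-+ a (suc m) n = cong (suc a ∷_)
  (trans (range-+ (suc a) m n) (cong (λ b → range (suc a) m ++ range b n) (sym (ℕP.+-suc a m))))

range-shift : ∀ a n → range a n ≡ map (a +_) (range 0 n)
range-shift a n = subst (λ b → range b n ≡ map (a +_) (range 0 n)) (ℕP.+-identityʳ a) (range-+-shift a 0 n)
  where
    range-+-shift : ∀ a b n → range (a + b) n ≡ map (a +_) (range b n)
    range-+-shift a b zero = refl
    range-+-shift a b (suc n) = cong₂ _∷_ (sym (ℕP.+-suc a b))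
      (trans (cong (λ c → range c n) (sym (ℕP.+-suc a b))) (range-+-shift a (suc b) n))

∈-range⁻ : ∀ {a n x} → x ∈ range a n → a < x × x ≤ a + n
∈-range⁻ {a} {suc n} (here refl) =
  ℕP.≤-refl , subst (suc a ≤_) (sym (ℕP.+-suc a n)) (s≤s (ℕP.m≤m+n a n))
∈-range⁻ {a} {suc n} {x} (there x∈) with ∈-range⁻ {suc a} {n} x∈
... | a<x , x≤ = ℕP.<-trans (ℕP.n<1+n a) a<x , subst (x ≤_) (sym (ℕP.+-suc a n)) x≤

∈-range⁺ : ∀ {a n x} → a < x → x ≤ a + n → x ∈ range a n
∈-range⁺ {a} {zero} a<x x≤a+0 =
  ⊥-elim (ℕP.<⇒≱ a<x (ℕP.≤-trans x≤a+0 (ℕP.≤-reflexive (ℕP.+-identityʳ a))))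
∈-range⁺ {a} {suc n} {x} a<x x≤ with x ℕP.≟ suc a
... | yes refl = here refl
... | no x≢ = there (∈-range⁺ (ℕP.≤∧≢⇒< a<x (x≢ ∘ sym)) (subst (x ≤_) (ℕP.+-suc a n) x≤))

range-increasing : ∀ a n → AllPairs _<_ (range a n)
range-increasing a zero = []
range-increasing a (suc n) = All.tabulate (proj₁ ∘ ∈-range⁻) ∷ range-increasing (suc a) n

-- classOf, with the colouring given as a list
colourClass : ∀ {A : Set} {k} → List (Fin k) → List A → Fin k → List A
colourClass cs xs j = map proj₂ (filter (λ p → proj₁ p FinP.≟ j) (zip cs xs))

module _ {A : Set} {k : ℕ} where

  colourClass-∷-≡ : ∀ {d j : Fin k} cs (x : A) xs → d ≡ j →
    colourClass (d ∷ cs) (x ∷ xs) j ≡ x ∷ colourClass cs xs j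
  colourClass-∷-≡ {d} {j} cs x xs d≡j with d FinP.≟ j
  ... | yes _ = refl
  ... | no d≢j = ⊥-elim (d≢j d≡j)

  colourClass-∷-≢ : ∀ {d j : Fin k} cs (x : A) xs → ¬ d ≡ j →
    colourClass (d ∷ cs) (x ∷ xs) j ≡ colourClass cs xs j
  colourClass-∷-≢ {d} {j} cs x xs d≢j with d FinP.≟ j
  ... | yes d≡j = ⊥-elim (d≢j d≡j)
  ... | no _ = refl

  colourClass-++ : ∀ (cs ds : List (Fin k)) (xs ys : List A) j → length cs ≡ length xs →
    colourClass (cs ++ ds) (xs ++ ys) j ≡ colourClass cs xs j ++ colourClass ds ys j
  colourClass-++ [] ds [] ys j _ = refl
  colourClass-++ (d ∷ cs) ds (x ∷ xs) ys j len≡ with d FinP.≟ j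
  ... | yes _ = cong (x ∷_) (colourClass-++ cs ds xs ys j (ℕP.suc-injective len≡))
  ... | no _ = colourClass-++ cs ds xs ys j (ℕP.suc-injective len≡)

  colourClass-map : ∀ {B : Set} (f : A → B) (cs : List (Fin k)) xs j →
    colourClass cs (map f xs) j ≡ map f (colourClass cs xs j)
  colourClass-map f [] xs j = refl
  colourClass-map f (d ∷ cs) [] j = refl
  colourClass-map f (d ∷ cs) (x ∷ xs) j with d FinP.≟ j
  ... | yes _ = cong (f x ∷_) (colourClass-map f cs xs j)
  ... | no _ = colourClass-map f cs xs j

  colourClass-All : ∀ {P : A → Set} (cs : List (Fin k)) {xs} j → All P xs → All P (colourClass cs xs j)
  colourClass-All [] j _ = []
  colourClass-All (d ∷ cs) {[]} j _ = []
  colourClass-All (d ∷ cs) {x ∷ xs} j (px ∷ pxs) with d FinP.≟ j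
  ... | yes _ = px ∷ colourClass-All cs j pxs
  ... | no _ = colourClass-All cs j pxs

  colourClass-replicate-≡ : ∀ (xs : List A) j → colourClass (replicate (length xs) j) xs j ≡ xs
  colourClass-replicate-≡ [] j = refl
  colourClass-replicate-≡ (x ∷ xs) j =
    trans (colourClass-∷-≡ {j} (replicate (length xs) j) x xs refl) (cong (x ∷_) (colourClass-replicate-≡ xs j))

  colourClass-replicate-≢ : ∀ n {d j : Fin k} (xs : List A) → ¬ d ≡ j → colourClass (replicate n d) xs j ≡ []
  colourClass-replicate-≢ zero xs d≢j = refl
  colourClass-replicate-≢ (suc n) [] d≢j = refl
  colourClass-replicate-≢ (suc n) {d} (x ∷ xs) d≢j =
    trans (colourClass-∷-≢ (replicate n d) x xs d≢j) (colourClass-replicate-≢ n xs d≢j)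

  colourClass-nonempty : ∀ (cs : List (Fin k)) (xs : List A) {j} → length cs ≡ length xs → j ∈ cs →
    1 ≤ length (colourClass cs xs j)
  colourClass-nonempty (d ∷ cs) (x ∷ xs) len≡ (here refl) =
    subst (λ ys → 1 ≤ length ys) (sym (colourClass-∷-≡ {d} cs x xs refl)) (s≤s z≤n)
  colourClass-nonempty (d ∷ cs) (x ∷ xs) {j} len≡ (there j∈) with d FinP.≟ j
  ... | yes _ = s≤s z≤n
  ... | no _ = colourClass-nonempty cs xs (ℕP.suc-injective len≡) j∈

  module _ {B : Set} where

    length-colourClass : ∀ (cs : List (Fin k)) (xs : List A) (ys : List B) j → length xs ≡ length ys →
      length (colourClass cs xs j) ≡ length (colourClass cs ys j)
    length-colourClass [] xs ys j _ = refl
    length-colourClass (d ∷ cs) [] [] j _ = refl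
    length-colourClass (d ∷ cs) (x ∷ xs) (y ∷ ys) j len≡ with d FinP.≟ j
    ... | yes _ = cong suc (length-colourClass cs xs ys j (ℕP.suc-injective len≡))
    ... | no _ = length-colourClass cs xs ys j (ℕP.suc-injective len≡)

    colourClass-zip-proj₁ : ∀ (cs : List (Fin k)) (xs : List A) (ys : List B) j → length xs ≡ length ys →
      map proj₁ (colourClass cs (zip xs ys) j) ≡ colourClass cs xs j
    colourClass-zip-proj₁ [] xs ys j _ = refl
    colourClass-zip-proj₁ (d ∷ cs) [] [] j _ = refl
    colourClass-zip-proj₁ (d ∷ cs) (x ∷ xs) (y ∷ ys) j len≡ with d FinP.≟ j
    ... | yes _ = cong (x ∷_) (colourClass-zip-proj₁ cs xs ys j (ℕP.suc-injective len≡))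
    ... | no _ = colourClass-zip-proj₁ cs xs ys j (ℕP.suc-injective len≡)

    colourClass-zip-proj₂ : ∀ (cs : List (Fin k)) (xs : List B) (ys : List A) j → length xs ≡ length ys →
      map proj₂ (colourClass cs (zip xs ys) j) ≡ colourClass cs ys j
    colourClass-zip-proj₂ [] xs ys j _ = refl
    colourClass-zip-proj₂ (d ∷ cs) [] [] j _ = refl
    colourClass-zip-proj₂ (d ∷ cs) (x ∷ xs) (y ∷ ys) j len≡ with d FinP.≟ j
    ... | yes _ = cong (y ∷_) (colourClass-zip-proj₂ cs xs ys j (ℕP.suc-injective len≡))
    ... | no _ = colourClass-zip-proj₂ cs xs ys j (ℕP.suc-injective len≡)

colourClass-increasing : ∀ {k} (cs : List (Fin k)) {xs} j → AllPairs _<_ xs → AllPairs _<_ (colourClass cs xs j)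
colourClass-increasing [] j _ = []
colourClass-increasing (d ∷ cs) {[]} j _ = []
colourClass-increasing (d ∷ cs) {x ∷ xs} j (x< ∷ xs<) with d FinP.≟ j
... | yes _ = colourClass-All cs j x< ∷ colourClass-increasing cs j xs<
... | no _ = colourClass-increasing cs j xs<

below : List ℕ → ℕ → ℕ
below xs x = length (filter (_<? x) xs)

-- For distinct entries, std xs is the permutation order-isomorphic to xs: the relabelling done by rel.
std : List ℕ → List ℕ
std xs = map (λ x → suc (below xs x)) xs

below-++ : ∀ xs ys x → below (xs ++ ys) x ≡ below xs x + below ys x
below-++ xs ys x = length-filter-++ (_<? x) xs ys

below-all : ∀ xs {x} → All (_< x) xs → below xs x ≡ length xs
below-all xs {x} h = cong length (ListP.filter-all (_<? x) h)

below-none : ∀ xs {x} → All (λ y → ¬ y < x) xs → below xs x ≡ 0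
below-none xs {x} h = cong length (ListP.filter-none (_<? x) h)

below-shift : ∀ a xs x → below (map (a +_) xs) (a + x) ≡ below xs x
below-shift a xs x = length-filter-map (_<? a + x) (_<? x) (a +_) xs
  (All.tabulate (λ {y} _ → ℕP.+-cancelˡ-< a y x , ℕP.+-monoʳ-< a))

below-↭ : ∀ {xs ys} x → xs ↭ ys → below xs x ≡ below ys x
below-↭ x xs↭ys = PermP.↭-length (PermP.filter-↭ (_<? x) xs↭ys)

below-range : ∀ n {x} → 1 ≤ x → x ≤ n → suc (below (range 0 n) x) ≡ x
below-range n {suc x} _ x<n = cong suc (begin
  below (range 0 n) (suc x)                                 ≡⟨ cong (λ m → below (range 0 m) (suc x)) (ℕP.m+[n∸m]≡n x≤n) ⟨
  below (range 0 (x + (n ∸ x))) (suc x)                     ≡⟨ cong (λ r → below r (suc x)) (range-+ 0 x (n ∸ x)) ⟩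
  below (range 0 x ++ range x (n ∸ x)) (suc x)              ≡⟨ below-++ (range 0 x) _ (suc x) ⟩
  below (range 0 x) (suc x) + below (range x (n ∸ x)) (suc x) ≡⟨ cong₂ _+_ lower upper ⟩
  x + 0                                                     ≡⟨ ℕP.+-identityʳ x ⟩
  x                                                         ∎)
  where
    open ≡-Reasoning
    x≤n : x ≤ n
    x≤n = ℕP.≤-trans (ℕP.n≤1+n x) x<n
    lower : below (range 0 x) (suc x) ≡ x
    lower = trans (below-all (range 0 x) (All.tabulate (s≤s ∘ proj₂ ∘ ∈-range⁻))) (length-range 0 x)
    upper : below (range x (n ∸ x)) (suc x) ≡ 0
    upper = below-none (range x (n ∸ x)) (All.tabulate (λ y∈ y≤x → ℕP.<⇒≱ (proj₁ (∈-range⁻ y∈)) (ℕP.≤-pred y≤x)))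

length-std : ∀ xs → length (std xs) ≡ length xs
length-std xs = ListP.length-map _ xs

std-bounded : ∀ xs → All (_≤ length (std xs)) (std xs)
std-bounded xs = subst (λ m → All (_≤ m) (std xs)) (sym (length-std xs)) (AllP.map⁺ (All.tabulate rank<length))
  where
    rank<length : ∀ {x} → x ∈ xs → below xs x < length xs
    rank<length {x} x∈ = ListP.filter-notAll (_<? x) xs (Any.map (λ { refl → ℕP.<-irrefl refl }) x∈)

std-increasing : ∀ {xs} → AllPairs _<_ xs → std xs ≡ range 0 (length xs)
std-increasing {[]} [] = refl
std-increasing {x ∷ xs} (x< ∷ xs<) = cong₂ _∷_ head tail
  where
    open ≡-Reasoning
    head : suc (below (x ∷ xs) x) ≡ 1
    head = cong suc (trans (cong length (ListP.filter-reject (_<? x) {x} {xs} (ℕP.<-irrefl refl)))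
             (below-none xs (All.map (λ x<y y<x → ℕP.<-asym x<y y<x) x<)))
    tail : map (λ y → suc (below (x ∷ xs) y)) xs ≡ range 1 (length xs)
    tail = begin
      map (λ y → suc (below (x ∷ xs) y)) xs
        ≡⟨ ListP.map-cong-local (All.map (λ {y} x<y → cong suc (cong length (ListP.filter-accept (_<? y) {x} {xs} x<y))) x<) ⟩
      map (λ y → suc (suc (below xs y))) xs ≡⟨ ListP.map-∘ xs ⟩
      map suc (std xs)                      ≡⟨ cong (map suc) (std-increasing xs<) ⟩
      map suc (range 0 (length xs))         ≡⟨ range-shift 1 (length xs) ⟨
      range 1 (length xs)                   ∎

length-⊞ : ∀ α β → length (α ⊞ β) ≡ length α + length β
length-⊞ α β = trans (ListP.length-++ α) (cong (length α +_) (ListP.length-map _ β))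

⊞-identityˡ : ∀ β → [] ⊞ β ≡ β
⊞-identityˡ = ListP.map-id

⊞-identityʳ : ∀ α → α ⊞ [] ≡ α
⊞-identityʳ = ListP.++-identityʳ

⊞-assoc : ∀ α β γ → (α ⊞ β) ⊞ γ ≡ α ⊞ (β ⊞ γ)
⊞-assoc α β γ = begin
  (α ++ map (length α +_) β) ++ map (length (α ⊞ β) +_) γ
    ≡⟨ ListP.++-assoc α _ _ ⟩
  α ++ (map (length α +_) β ++ map (length (α ⊞ β) +_) γ)
    ≡⟨ cong (λ δ → α ++ (map (length α +_) β ++ δ)) shift-twice ⟩
  α ++ (map (length α +_) β ++ map (length α +_) (map (length β +_) γ))
    ≡⟨ cong (α ++_) (ListP.map-++ (length α +_) β _) ⟨
  α ⊞ (β ⊞ γ) ∎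
  where
    open ≡-Reasoning
    shift-twice : map (length (α ⊞ β) +_) γ ≡ map (length α +_) (map (length β +_) γ)
    shift-twice = trans
      (ListP.map-cong (λ x → trans (cong (_+ x) (length-⊞ α β)) (ℕP.+-assoc (length α) (length β) x)) γ)
      (ListP.map-∘ γ)

sumPerms-++ : ∀ σs τs → sumPerms (σs ++ τs) ≡ sumPerms σs ⊞ sumPerms τs
sumPerms-++ [] τs = sym (⊞-identityˡ (sumPerms τs))
sumPerms-++ (σ ∷ σs) τs =
  trans (cong (σ ⊞_) (sumPerms-++ σs τs)) (sym (⊞-assoc σ (sumPerms σs) (sumPerms τs)))

foldl-⊞ : ∀ α σss → foldl _⊞_ α (map sumPerms σss) ≡ α ⊞ sumPerms (concat σss)
foldl-⊞ α [] = sym (⊞-identityʳ α)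
foldl-⊞ α (σs ∷ σss) = begin
  foldl _⊞_ (α ⊞ sumPerms σs) (map sumPerms σss) ≡⟨ foldl-⊞ (α ⊞ sumPerms σs) σss ⟩
  (α ⊞ sumPerms σs) ⊞ sumPerms (concat σss)      ≡⟨ ⊞-assoc α (sumPerms σs) _ ⟩
  α ⊞ (sumPerms σs ⊞ sumPerms (concat σss))      ≡⟨ cong (α ⊞_) (sumPerms-++ σs (concat σss)) ⟨
  α ⊞ sumPerms (concat (σs ∷ σss))              ∎
  where open ≡-Reasoning

std-⊞ : ∀ a xs ys → All (_≤ a) xs → All (1 ≤_) ys → std (xs ++ map (a +_) ys) ≡ std xs ⊞ std ys
std-⊞ a xs ys xs≤a ys≥1 = begin
  map label (xs ++ map (a +_) ys)              ≡⟨ ListP.map-++ label xs _ ⟩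
  map label xs ++ map label (map (a +_) ys)     ≡⟨ cong₂ _++_ left (trans (sym (ListP.map-∘ ys)) right) ⟩
  std xs ++ map (length (std xs) +_) (std ys) ∎
  where
    open ≡-Reasoning
    zs : List ℕ
    zs = xs ++ map (a +_) ys
    label : ℕ → ℕ
    label x = suc (below zs x)
    below-left : ∀ {x} → x ≤ a → below zs x ≡ below xs x
    below-left {x} x≤a = trans (below-++ xs _ x)
      (trans (cong (below xs x +_) (below-none (map (a +_) ys) (AllP.map⁺
          (All.map (λ {b} b≥1 a+b<x → ℕP.<⇒≱ a+b<x (ℕP.≤-trans x≤a (ℕP.m≤m+n a b))) ys≥1))))
        (ℕP.+-identityʳ _))
    below-right : ∀ {b} → 1 ≤ b → below zs (a + b) ≡ length (std xs) + below ys b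
    below-right {b} b≥1 = trans (below-++ xs _ (a + b)) (cong₂ _+_
      (trans (below-all xs (All.map (λ x≤a → ℕP.≤-trans (s≤s x≤a) a<a+b) xs≤a)) (sym (length-std xs)))
      (below-shift a ys b))
      where
        a<a+b : a < a + b
        a<a+b = subst (_≤ a + b) (ℕP.+-comm a 1) (ℕP.+-monoʳ-≤ a b≥1)
    left : map label xs ≡ std xs
    left = ListP.map-cong-local (All.map (cong suc ∘ below-left) xs≤a)
    right : map (λ y → label (a + y)) ys ≡ map (length (std xs) +_) (std ys)
    right = trans (ListP.map-cong-local (All.map (λ b≥1 → trans (cong suc (below-right b≥1)) (sym (ℕP.+-suc _ _))) ys≥1))
      (ListP.map-∘ ys)

IsPerm⇒↭range : ∀ {n σ} → IsPerm n σ → σ ↭ range 0 n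
IsPerm⇒↭range {n} σ-perm = subst (_ ↭_) (map-suc-upTo n) σ-perm

range⇒IsPerm : ∀ {σ} → σ ↭ range 0 (length σ) → IsPerm (length σ) σ
range⇒IsPerm {σ} σ↭ = subst (σ ↭_) (sym (map-suc-upTo (length σ))) σ↭

IsPerm⇒length : ∀ {n σ} → IsPerm n σ → length σ ≡ n
IsPerm⇒length {n} σ-perm = trans (PermP.↭-length (IsPerm⇒↭range σ-perm)) (length-range 0 n)

IsPerm⇒∈ : ∀ {n σ x} → IsPerm n σ → x ∈ σ → 1 ≤ x × x ≤ n
IsPerm⇒∈ σ-perm x∈ = ∈-range⁻ (PermP.∈-resp-↭ (IsPerm⇒↭range σ-perm) x∈)

IsPerm⇒All≤ : ∀ {n σ} → IsPerm n σ → All (_≤ n) σ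
IsPerm⇒All≤ σ-perm = All.tabulate (proj₂ ∘ IsPerm⇒∈ σ-perm)

std-IsPerm : ∀ {n σ} → IsPerm n σ → std σ ≡ σ
std-IsPerm {n} σ-perm = ListP.map-id-local (All.tabulate (λ {x} x∈ →
  let 1≤x , x≤n = IsPerm⇒∈ σ-perm x∈ in
  trans (cong suc (below-↭ x (IsPerm⇒↭range σ-perm))) (below-range n 1≤x x≤n)))

sumPerms-≥1 : ∀ {σs} → All Indecomposable σs → All (1 ≤_) (sumPerms σs)
sumPerms-≥1 [] = []
sumPerms-≥1 {σ ∷ σs} (σ-ind ∷ σs-ind) = AllP.++⁺
  (All.tabulate (proj₁ ∘ IsPerm⇒∈ (proj₁ σ-ind)))
  (AllP.map⁺ (All.map (λ {x} 1≤x → ℕP.≤-trans 1≤x (ℕP.m≤n+m x (length σ))) (sumPerms-≥1 σs-ind)))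

-- Cuts and components

-- For a permutation, a cut at o means that it splits as a sum at position o.
Cut : List ℕ → ℕ → Set
Cut xs o = All (_≤ o) (take o xs)

Cut? : (xs : List ℕ) → Decidable (Cut xs)
Cut? xs o = All.all? (_≤? o) (take o xs)

components : List ℕ → ℕ
components xs = length (filter (Cut? xs) (range 0 (length xs)))

components-⊞ : ∀ α β → All (_≤ length α) α → components (α ⊞ β) ≡ components α + components β
components-⊞ α β α≤a = begin
  length (filter (Cut? (α ⊞ β)) (range 0 (length (α ⊞ β))))
    ≡⟨ cong (λ r → length (filter (Cut? (α ⊞ β)) r)) (trans (cong (range 0) (length-⊞ α β)) (range-+ 0 a (length β))) ⟩
  length (filter (Cut? (α ⊞ β)) (range 0 a ++ range a (length β)))
    ≡⟨ length-filter-++ (Cut? (α ⊞ β)) (range 0 a) _ ⟩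
  length (filter (Cut? (α ⊞ β)) (range 0 a)) + length (filter (Cut? (α ⊞ β)) (range a (length β)))
    ≡⟨ cong₂ _+_ (length-filter-cong (Cut? (α ⊞ β)) (Cut? α) (range 0 a) (All.tabulate cut-left))
                 (trans (cong (λ r → length (filter (Cut? (α ⊞ β)) r)) (range-shift a (length β)))
                        (length-filter-map (Cut? (α ⊞ β)) (Cut? β) (a +_) (range 0 (length β)) (All.tabulate (λ _ → cut-right _)))) ⟩
  components α + components β ∎
  where
    open ≡-Reasoning
    a : ℕ
    a = length α
    cut-left : ∀ {o} → o ∈ range 0 a → (Cut (α ⊞ β) o → Cut α o) × (Cut α o → Cut (α ⊞ β) o)
    cut-left {o} o∈ = subst (All (_≤ o)) take≡ , subst (All (_≤ o)) (sym take≡)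
      where
        take≡ : take o (α ⊞ β) ≡ take o α
        take≡ = take-++-≤ o α (map (a +_) β) (proj₂ (∈-range⁻ o∈))
    cut-right : ∀ o → (Cut (α ⊞ β) (a + o) → Cut β o) × (Cut β o → Cut (α ⊞ β) (a + o))
    cut-right o = to , from
      where
        take≡ : take (a + o) (α ⊞ β) ≡ α ++ map (a +_) (take o β)
        take≡ = trans (take-++-+ o α (map (a +_) β)) (cong (α ++_) (ListP.take-map o β))
        to : Cut (α ⊞ β) (a + o) → Cut β o
        to cut = All.map (ℕP.+-cancelˡ-≤ a _ _) (AllP.map⁻ (AllP.++⁻ʳ α (subst (All (_≤ a + o)) take≡ cut)))
        from : Cut β o → Cut (α ⊞ β) (a + o)
        from cut = subst (All (_≤ a + o)) (sym take≡)
          (AllP.++⁺ (All.map (λ x≤a → ℕP.≤-trans x≤a (ℕP.m≤m+n a o)) α≤a) (AllP.map⁺ (All.map (ℕP.+-monoʳ-≤ a) cut)))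

components-positive : ∀ xs → 1 ≤ length xs → All (_≤ length xs) xs → 1 ≤ components xs
components-positive xs 1≤len xs≤len = ListP.filter-some (Cut? xs) (lose (∈-range⁺ 1≤len ℕP.≤-refl)
  (subst (All (_≤ length xs)) (sym (ListP.take-all (length xs) xs ℕP.≤-refl)) xs≤len))

range-split : ∀ {o n} → o ≤ n → range 0 n ≡ range 0 o ++ range o (n ∸ o)
range-split {o} {n} o≤n = trans (cong (range 0) (sym (ℕP.m+[n∸m]≡n o≤n))) (range-+ 0 o (n ∸ o))

module _ {n σ o} (σ-perm : IsPerm n σ) (o≤n : o ≤ n) (cut : Cut σ o) where

  private
    σ↭ : σ ↭ range 0 n
    σ↭ = IsPerm⇒↭range σ-perm

    lower-range : ∀ {x} → x ∈ range 0 o → x ≤ o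
    lower-range = proj₂ ∘ ∈-range⁻

    upper-range : ∀ {x} → x ∈ range o (n ∸ o) → o < x
    upper-range = proj₁ ∘ ∈-range⁻

    filter-≤-range : filter (_≤? o) (range 0 n) ≡ range 0 o
    filter-≤-range = begin
      filter (_≤? o) (range 0 n)                                             ≡⟨ cong (filter (_≤? o)) (range-split o≤n) ⟩
      filter (_≤? o) (range 0 o ++ range o (n ∸ o))                          ≡⟨ ListP.filter-++ (_≤? o) (range 0 o) _ ⟩
      filter (_≤? o) (range 0 o) ++ filter (_≤? o) (range o (n ∸ o))         ≡⟨ cong₂ _++_
        (ListP.filter-all (_≤? o) (All.tabulate lower-range))
        (ListP.filter-none (_≤? o) (All.tabulate (ℕP.<⇒≱ ∘ upper-range))) ⟩
      range 0 o ++ []                                                        ≡⟨ ListP.++-identityʳ _ ⟩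
      range 0 o                                                              ∎
      where open ≡-Reasoning

    filter->-range : filter (o <?_) (range 0 n) ≡ range o (n ∸ o)
    filter->-range = begin
      filter (o <?_) (range 0 n)                                             ≡⟨ cong (filter (o <?_)) (range-split o≤n) ⟩
      filter (o <?_) (range 0 o ++ range o (n ∸ o))                          ≡⟨ ListP.filter-++ (o <?_) (range 0 o) _ ⟩
      filter (o <?_) (range 0 o) ++ filter (o <?_) (range o (n ∸ o))         ≡⟨ cong₂ _++_
        (ListP.filter-none (o <?_) (All.tabulate (ℕP.≤⇒≯ ∘ lower-range)))
        (ListP.filter-all (o <?_) (All.tabulate upper-range)) ⟩
      range o (n ∸ o)                                                        ∎
      where open ≡-Reasoning

    filter-≤ : filter (_≤? o) σ ≡ take o σ ++ filter (_≤? o) (drop o σ)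
    filter-≤ = trans (cong (filter (_≤? o)) (sym (ListP.take++drop≡id o σ)))
      (trans (ListP.filter-++ (_≤? o) (take o σ) (drop o σ)) (cong (_++ filter (_≤? o) (drop o σ)) (ListP.filter-all (_≤? o) cut)))

    length-take : length (take o σ) ≡ o
    length-take = trans (ListP.length-take o σ) (ℕP.m≤n⇒m⊓n≡m (subst (o ≤_) (sym (IsPerm⇒length σ-perm)) o≤n))

    -- the first o entries already exhaust the o values ≤ o
    no-small-after : length (filter (_≤? o) (drop o σ)) ≡ 0
    no-small-after = ℕP.+-cancelˡ-≡ o _ 0 (begin
      o + length (filter (_≤? o) (drop o σ))               ≡⟨ cong (_+ length (filter (_≤? o) (drop o σ))) length-take ⟨
      length (take o σ) + length (filter (_≤? o) (drop o σ)) ≡⟨ ListP.length-++ (take o σ) ⟨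
      length (take o σ ++ filter (_≤? o) (drop o σ))       ≡⟨ cong length filter-≤ ⟨
      length (filter (_≤? o) σ)                            ≡⟨ PermP.↭-length (PermP.filter-↭ (_≤? o) σ↭) ⟩
      length (filter (_≤? o) (range 0 n))                  ≡⟨ cong length filter-≤-range ⟩
      length (range 0 o)                                   ≡⟨ length-range 0 o ⟩
      o                                                    ≡⟨ ℕP.+-identityʳ o ⟨
      o + 0                                                ∎)
      where open ≡-Reasoning

  cut-drop-above : All (o <_) (drop o σ)
  cut-drop-above = All.map ℕP.≰⇒> (AllP.¬Any⇒All¬ (drop o σ) (λ some →
    ℕP.<-irrefl (sym no-small-after) (ListP.filter-some (_≤? o) some)))

  cut-take-↭ : take o σ ↭ range 0 o
  cut-take-↭ = subst (_↭ range 0 o) take≡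
    (subst (filter (_≤? o) σ ↭_) filter-≤-range (PermP.filter-↭ (_≤? o) σ↭))
    where
      take≡ : filter (_≤? o) σ ≡ take o σ
      take≡ = trans filter-≤ (trans (cong (take o σ ++_) (ListP.filter-none (_≤? o) (All.map ℕP.<⇒≱ cut-drop-above)))
                                    (ListP.++-identityʳ _))

  cut-drop-↭ : drop o σ ↭ range o (n ∸ o)
  cut-drop-↭ = subst (_↭ range o (n ∸ o)) drop≡
    (subst (filter (o <?_) σ ↭_) filter->-range (PermP.filter-↭ (o <?_) σ↭))
    where
      drop≡ : filter (o <?_) σ ≡ drop o σ
      drop≡ = begin
        filter (o <?_) σ                                          ≡⟨ cong (filter (o <?_)) (ListP.take++drop≡id o σ) ⟨
        filter (o <?_) (take o σ ++ drop o σ)                     ≡⟨ ListP.filter-++ (o <?_) (take o σ) (drop o σ) ⟩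
        filter (o <?_) (take o σ) ++ filter (o <?_) (drop o σ)    ≡⟨ cong₂ _++_
          (ListP.filter-none (o <?_) (All.map ℕP.≤⇒≯ cut)) (ListP.filter-all (o <?_) cut-drop-above) ⟩
        drop o σ                                                  ∎
        where open ≡-Reasoning

cut⇒decomposable : ∀ {n σ o} → IsPerm n σ → 1 ≤ o → o < n → Cut σ o → Decomposable σ
cut⇒decomposable {n} {σ} {o} σ-perm 1≤o o<n cut =
  α , β , range⇒IsPerm α↭ , range⇒IsPerm β↭ ,
  subst (1 ≤_) (sym length-α) 1≤o , subst (1 ≤_) (sym length-β) (ℕP.m<n⇒0<n∸m o<n) , σ≡α⊞β
  where
    o≤n : o ≤ n
    o≤n = ℕP.<⇒≤ o<n
    α β : List ℕ
    α = take o σ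
    β = map (_∸ o) (drop o σ)
    length-α : length α ≡ o
    length-α = trans (PermP.↭-length (cut-take-↭ σ-perm o≤n cut)) (length-range 0 o)
    length-β : length β ≡ n ∸ o
    length-β = trans (ListP.length-map _ (drop o σ)) (trans (ListP.length-drop o σ) (cong (_∸ o) (IsPerm⇒length σ-perm)))
    α↭ : α ↭ range 0 (length α)
    α↭ = subst (λ m → α ↭ range 0 m) (sym length-α) (cut-take-↭ σ-perm o≤n cut)
    β↭ : β ↭ range 0 (length β)
    β↭ = subst (λ m → β ↭ range 0 m) (sym length-β) (subst (β ↭_) unshift (PermP.map⁺ (_∸ o) (cut-drop-↭ σ-perm o≤n cut)))
      where
        unshift : map (_∸ o) (range o (n ∸ o)) ≡ range 0 (n ∸ o)
        unshift = trans (cong (map (_∸ o)) (range-shift o (n ∸ o)))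
          (trans (sym (ListP.map-∘ (range 0 (n ∸ o)))) (ListP.map-id-local (All.tabulate (λ {x} _ → ℕP.m+n∸m≡n o x))))
    σ≡α⊞β : σ ≡ α ⊞ β
    σ≡α⊞β = trans (sym (ListP.take++drop≡id o σ)) (cong (α ++_) (sym (trans (sym (ListP.map-∘ (drop o σ)))
      (ListP.map-id-local (All.map (λ {y} o<y → trans (cong (_+ (y ∸ o)) length-α) (ℕP.m+[n∸m]≡n (ℕP.<⇒≤ o<y)))
        (cut-drop-above σ-perm o≤n cut))))))

indecomposable⇒no-inner-cut : ∀ {σ} → Indecomposable σ → ∀ {o} → 1 ≤ o → o < length σ → ¬ Cut σ o
indecomposable⇒no-inner-cut (σ-perm , _ , ¬dec) 1≤o o<len cut = ¬dec (cut⇒decomposable σ-perm 1≤o o<len cut)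

IsPerm⇒full-cut : ∀ {σ} → IsPerm (length σ) σ → Cut σ (length σ)
IsPerm⇒full-cut {σ} σ-perm = subst (All (_≤ length σ)) (sym (ListP.take-all (length σ) σ ℕP.≤-refl)) (IsPerm⇒All≤ σ-perm)

components-indecomposable : ∀ {σ} → Indecomposable σ → components σ ≡ 1
components-indecomposable {σ} σ-ind = count-cuts (length σ) refl (proj₁ (proj₂ σ-ind))
  where
    open ≡-Reasoning
    count-cuts : ∀ L → length σ ≡ L → 1 ≤ L → length (filter (Cut? σ) (range 0 L)) ≡ 1
    count-cuts (suc m) len≡ _ = begin
      length (filter (Cut? σ) (range 0 (suc m)))
        ≡⟨ cong (length ∘ filter (Cut? σ)) (trans (cong (range 0) (ℕP.+-comm 1 m)) (range-+ 0 m 1)) ⟩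
      length (filter (Cut? σ) (range 0 m ++ suc m ∷ []))
        ≡⟨ length-filter-++ (Cut? σ) (range 0 m) _ ⟩
      length (filter (Cut? σ) (range 0 m)) + length (filter (Cut? σ) (suc m ∷ []))
        ≡⟨ cong₂ _+_ (cong length (ListP.filter-none (Cut? σ) (All.tabulate no-inner-cut)))
                     (cong length (ListP.filter-accept (Cut? σ) last-cut)) ⟩
      1 ∎
      where
        no-inner-cut : ∀ {o} → o ∈ range 0 m → ¬ Cut σ o
        no-inner-cut o∈ = indecomposable⇒no-inner-cut σ-ind (proj₁ (∈-range⁻ o∈))
          (subst (_ <_) (sym len≡) (s≤s (proj₂ (∈-range⁻ o∈))))
        last-cut : Cut σ (suc m)
        last-cut = subst (Cut σ) len≡ (IsPerm⇒full-cut (proj₁ σ-ind))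

components-sumPerms : ∀ {σs} → All Indecomposable σs → components (sumPerms σs) ≡ length σs
components-sumPerms [] = refl
components-sumPerms {σ ∷ σs} (σ-ind ∷ σs-ind) =
  trans (components-⊞ σ (sumPerms σs) (IsPerm⇒All≤ (proj₁ σ-ind)))
        (cong₂ _+_ (components-indecomposable σ-ind) (components-sumPerms σs-ind))

⊞-prefix : ∀ σ τ X Y → σ ⊞ X ≡ τ ⊞ Y → length σ ≤ length τ → take (length σ) τ ≡ σ
⊞-prefix σ τ X Y σX≡τY |σ|≤|τ| = begin
  take (length σ) τ                                 ≡⟨ take-++-≤ (length σ) τ (map (length τ +_) Y) |σ|≤|τ| ⟨
  take (length σ) (τ ⊞ Y)                           ≡⟨ cong (take (length σ)) σX≡τY ⟨
  take (length σ) (σ ⊞ X)                           ≡⟨ take-++-≤ (length σ) σ (map (length σ +_) X) ℕP.≤-refl ⟩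
  take (length σ) σ                                 ≡⟨ ListP.take-all (length σ) σ ℕP.≤-refl ⟩
  σ                                                 ∎
  where open ≡-Reasoning

⊞-cancelˡ : ∀ σ X Y → σ ⊞ X ≡ σ ⊞ Y → X ≡ Y
⊞-cancelˡ σ X Y σX≡σY = ListP.map-injective (ℕP.+-cancelˡ-≡ (length σ) _ _)
  (trans (sym (drop-++ σ _)) (trans (cong (drop (length σ)) σX≡σY) (drop-++ σ _)))

⊞-nonempty : ∀ τ Y → 1 ≤ length τ → ¬ [] ≡ τ ⊞ Y
⊞-nonempty (_ ∷ _) Y _ ()

-- A shorter first block would give an inner cut of the longer one.
sumPerms-injective : ∀ {σs τs} → All Indecomposable σs → All Indecomposable τs →
  sumPerms σs ≡ sumPerms τs → σs ≡ τs
sumPerms-injective [] [] _ = refl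
sumPerms-injective {τs = τ ∷ _} [] ((_ , 1≤len , _) ∷ _) eq = ⊥-elim (⊞-nonempty τ _ 1≤len eq)
sumPerms-injective {σ ∷ _} ((_ , 1≤len , _) ∷ _) [] eq = ⊥-elim (⊞-nonempty σ _ 1≤len (sym eq))
sumPerms-injective {σ ∷ σs} {τ ∷ τs} (σ-ind ∷ σs-ind) (τ-ind ∷ τs-ind) eq with ℕP.<-cmp (length σ) (length τ)
... | tri< |σ|<|τ| _ _ = ⊥-elim (indecomposable⇒no-inner-cut τ-ind (proj₁ (proj₂ σ-ind)) |σ|<|τ|
        (subst (All (_≤ length σ)) (sym (⊞-prefix σ τ _ _ eq (ℕP.<⇒≤ |σ|<|τ|))) (IsPerm⇒All≤ (proj₁ σ-ind))))
... | tri> _ _ |τ|<|σ| = ⊥-elim (indecomposable⇒no-inner-cut σ-ind (proj₁ (proj₂ τ-ind)) |τ|<|σ|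
        (subst (All (_≤ length τ)) (sym (⊞-prefix τ σ _ _ (sym eq) (ℕP.<⇒≤ |τ|<|σ|))) (IsPerm⇒All≤ (proj₁ τ-ind))))
... | tri≈ _ |σ|≡|τ| _ = cong₂ _∷_ σ≡τ (sumPerms-injective σs-ind τs-ind (⊞-cancelˡ τ _ _ (subst (λ ρ → ρ ⊞ _ ≡ τ ⊞ _) σ≡τ eq)))
  where
    σ≡τ : σ ≡ τ
    σ≡τ = trans (sym (⊞-prefix σ τ _ _ eq (ℕP.≤-reflexive |σ|≡|τ|)))
            (trans (cong (λ m → take m τ) |σ|≡|τ|) (ListP.take-all (length τ) τ ℕP.≤-refl))

⊞-bounded : ∀ α β → All (_≤ length α) α → All (_≤ length β) β → All (_≤ length (α ⊞ β)) (α ⊞ β)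
⊞-bounded α β α≤ β≤ = subst (λ m → All (_≤ m) (α ⊞ β)) (sym (length-⊞ α β))
  (AllP.++⁺ (All.map (λ x≤ → ℕP.≤-trans x≤ (ℕP.m≤m+n _ _)) α≤) (AllP.map⁺ (All.map (ℕP.+-monoʳ-≤ (length α)) β≤)))

components-foldl-⊞ : ∀ α τs → All (_≤ length α) α → All (λ τ → All (_≤ length τ) τ) τs →
  components (foldl _⊞_ α τs) ≡ components α + sum (map components τs)
components-foldl-⊞ α [] _ _ = sym (ℕP.+-identityʳ (components α))
components-foldl-⊞ α (τ ∷ τs) α≤ (τ≤ ∷ τs≤) = begin
  components (foldl _⊞_ (α ⊞ τ) τs)                                ≡⟨ components-foldl-⊞ (α ⊞ τ) τs (⊞-bounded α τ α≤ τ≤) τs≤ ⟩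
  components (α ⊞ τ) + sum (map components τs)                     ≡⟨ cong (_+ _) (components-⊞ α τ α≤) ⟩
  components α + components τ + sum (map components τs)            ≡⟨ ℕP.+-assoc (components α) _ _ ⟩
  components α + sum (map components (τ ∷ τs))                     ∎
  where open ≡-Reasoning

-- Colourings of a sum of permutations

module _ {k : ℕ} where

  std-colourClass-⊞ : ∀ σ τ (cs ds : List (Fin k)) j → All (_≤ length σ) σ → All (1 ≤_) τ → length cs ≡ length σ →
    std (colourClass (cs ++ ds) (σ ⊞ τ) j) ≡ std (colourClass cs σ j) ⊞ std (colourClass ds τ j)
  std-colourClass-⊞ σ τ cs ds j σ≤ τ≥1 len≡ = begin
    std (colourClass (cs ++ ds) (σ ++ map (length σ +_) τ) j)
      ≡⟨ cong std (colourClass-++ cs ds σ _ j len≡) ⟩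
    std (colourClass cs σ j ++ colourClass ds (map (length σ +_) τ) j)
      ≡⟨ cong (λ ρ → std (colourClass cs σ j ++ ρ)) (colourClass-map (length σ +_) ds τ j) ⟩
    std (colourClass cs σ j ++ map (length σ +_) (colourClass ds τ j))
      ≡⟨ std-⊞ (length σ) _ _ (colourClass-All cs j σ≤) (colourClass-All ds j τ≥1) ⟩
    std (colourClass cs σ j) ⊞ std (colourClass ds τ j) ∎
    where open ≡-Reasoning

  blockColouring : List (List ℕ) → List (Fin k) → List (Fin k)
  blockColouring (σ ∷ σs) (d ∷ ds) = replicate (length σ) d ++ blockColouring σs ds
  blockColouring _ _ = []

  length-blockColouring : ∀ σs ds → length ds ≡ length σs → length (blockColouring σs ds) ≡ length (sumPerms σs)
  length-blockColouring [] [] _ = refl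
  length-blockColouring (σ ∷ σs) (d ∷ ds) len≡ = begin
    length (replicate (length σ) d ++ blockColouring σs ds)         ≡⟨ ListP.length-++ (replicate (length σ) d) ⟩
    length (replicate (length σ) d) + length (blockColouring σs ds) ≡⟨ cong₂ _+_ (ListP.length-replicate (length σ))
                                                                         (length-blockColouring σs ds (ℕP.suc-injective len≡)) ⟩
    length σ + length (sumPerms σs)                                 ≡⟨ length-⊞ σ (sumPerms σs) ⟨
    length (sumPerms (σ ∷ σs))                                      ∎
    where open ≡-Reasoning

  ∈-blockColouring⁻ : ∀ σs (ds : List (Fin k)) {j} → j ∈ blockColouring σs ds → j ∈ ds
  ∈-blockColouring⁻ (σ ∷ σs) (d ∷ ds) j∈ with ∈-++⁻ (replicate (length σ) d) j∈
  ... | inj₁ j∈d* = here (All.lookup (AllP.replicate⁺ {P = _≡ d} (length σ) refl) j∈d*)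
  ... | inj₂ j∈rest = there (∈-blockColouring⁻ σs ds j∈rest)

  ∈-blockColouring⁺ : ∀ {σs} (ds : List (Fin k)) {j} → All (λ σ → 1 ≤ length σ) σs → length ds ≡ length σs →
    j ∈ ds → j ∈ blockColouring σs ds
  ∈-blockColouring⁺ {σ ∷ σs} (d ∷ ds) (1≤|σ| ∷ _) _ (here refl) with length σ
  ... | suc _ = here refl
  ∈-blockColouring⁺ {σ ∷ σs} (d ∷ ds) (_ ∷ nonempty) len≡ (there j∈) =
    ∈-++⁺ʳ (replicate (length σ) d) (∈-blockColouring⁺ ds nonempty (ℕP.suc-injective len≡) j∈)

  blockColouring-injective : ∀ {σs} (ds es : List (Fin k)) → All (λ σ → 1 ≤ length σ) σs →
    length ds ≡ length σs → length es ≡ length σs → blockColouring σs ds ≡ blockColouring σs es → ds ≡ es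
  blockColouring-injective {[]} [] [] _ _ _ _ = refl
  blockColouring-injective {σ ∷ σs} (d ∷ ds) (e ∷ es) (1≤|σ| ∷ nonempty) |ds| |es| eq
    with replicate-++-head (length σ) 1≤|σ| eq
  ... | refl = cong (d ∷_) (blockColouring-injective ds es nonempty (ℕP.suc-injective |ds|) (ℕP.suc-injective |es|)
                             (ListP.++-cancelˡ (replicate (length σ) d) _ _ eq))

  std-colourClass-blockColouring : ∀ {σs} (ds : List (Fin k)) j → All Indecomposable σs → length ds ≡ length σs →
    std (colourClass (blockColouring σs ds) (sumPerms σs) j) ≡ sumPerms (colourClass ds σs j)
  std-colourClass-blockColouring {[]} [] j _ _ = refl
  std-colourClass-blockColouring {σ ∷ σs} (d ∷ ds) j (σ-ind ∷ σs-ind) len≡ =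
    trans (std-colourClass-⊞ σ (sumPerms σs) (replicate (length σ) d) _ j (IsPerm⇒All≤ (proj₁ σ-ind))
             (sumPerms-≥1 σs-ind) (ListP.length-replicate (length σ)))
          (trans (cong (std (colourClass (replicate (length σ) d) σ j) ⊞_)
                       (std-colourClass-blockColouring ds j σs-ind (ℕP.suc-injective len≡)))
                 first-block)
    where
      first-block : std (colourClass (replicate (length σ) d) σ j) ⊞ sumPerms (colourClass ds σs j)
                  ≡ sumPerms (colourClass (d ∷ ds) (σ ∷ σs) j)
      first-block with d FinP.≟ j
      ... | yes refl = cong (_⊞ _) (trans (cong std (colourClass-replicate-≡ σ d)) (std-IsPerm (proj₁ σ-ind)))
      ... | no d≢j = trans (cong (λ ρ → std ρ ⊞ _) (colourClass-replicate-≢ (length σ) σ d≢j)) (⊞-identityˡ _)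

  -- the analogue of reconstruct for permutations
  reconstructPerm : List (Fin k) → List ℕ → List ℕ
  reconstructPerm cs π = foldl _⊞_ [] (map (λ j → std (colourClass cs π j)) (allFin k))

  -- readIn, with the colouring given as a list
  readInList : ∀ {A : Set} → List (Fin k) → List A → List A
  readInList cs w = concat (map (colourClass cs w) (allFin k))

  reconstructPerm-blockColouring : ∀ {σs} (ds : List (Fin k)) → All Indecomposable σs → length ds ≡ length σs →
    reconstructPerm (blockColouring σs ds) (sumPerms σs) ≡ sumPerms (readInList ds σs)
  reconstructPerm-blockColouring {σs} ds σs-ind len≡ = begin
    foldl _⊞_ [] (map (λ j → std (colourClass (blockColouring σs ds) (sumPerms σs) j)) (allFin k))
      ≡⟨ cong (foldl _⊞_ []) (ListP.map-cong (λ j → std-colourClass-blockColouring ds j σs-ind len≡) (allFin k)) ⟩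
    foldl _⊞_ [] (map (λ j → sumPerms (colourClass ds σs j)) (allFin k))
      ≡⟨ cong (foldl _⊞_ []) (ListP.map-∘ (allFin k)) ⟩
    foldl _⊞_ [] (map sumPerms (map (colourClass ds σs) (allFin k)))
      ≡⟨ foldl-⊞ [] (map (colourClass ds σs) (allFin k)) ⟩
    [] ⊞ sumPerms (readInList ds σs)
      ≡⟨ ⊞-identityˡ _ ⟩
    sumPerms (readInList ds σs) ∎
    where open ≡-Reasoning

  readInList-All : ∀ {A : Set} {P : A → Set} (cs : List (Fin k)) {w} → All P w → All P (readInList cs w)
  readInList-All cs all = AllP.concat⁺ (AllP.map⁺ {xs = allFin k} (All.tabulate (λ {j} _ → colourClass-All cs j all)))

  classComponents : List (Fin k) → List ℕ → ℕ
  classComponents cs π = sum (map (λ j → components (std (colourClass cs π j))) (allFin k))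

  components-reconstructPerm : ∀ cs π → components (reconstructPerm cs π) ≡ classComponents cs π
  components-reconstructPerm cs π = trans
    (components-foldl-⊞ [] (map (λ j → std (colourClass cs π j)) (allFin k)) []
       (AllP.map⁺ (All.tabulate (λ {j} _ → std-bounded (colourClass cs π j)))))
    (cong sum (sym (ListP.map-∘ (allFin k))))

  classComponents-⊞ : ∀ σ τ (cs ds : List (Fin k)) → All (_≤ length σ) σ → All (1 ≤_) τ → length cs ≡ length σ →
    classComponents (cs ++ ds) (σ ⊞ τ) ≡ classComponents cs σ + classComponents ds τ
  classComponents-⊞ σ τ cs ds σ≤ τ≥1 len≡ = trans
    (cong sum (ListP.map-cong (λ j → trans (cong components (std-colourClass-⊞ σ τ cs ds j σ≤ τ≥1 len≡))
                                           (components-⊞ _ _ (std-bounded (colourClass cs σ j)))) (allFin k)))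
    (sum-map-+ _ _ (allFin k))

  components-std-colourClass-positive : ∀ (cs : List (Fin k)) σ {j} → length cs ≡ length σ → j ∈ cs →
    1 ≤ components (std (colourClass cs σ j))
  components-std-colourClass-positive cs σ {j} len≡ j∈ = components-positive (std (colourClass cs σ j))
    (subst (1 ≤_) (sym (length-std (colourClass cs σ j))) (colourClass-nonempty cs σ len≡ j∈))
    (std-bounded (colourClass cs σ j))

  classComponents-positive : ∀ (cs : List (Fin k)) σ {j} → length cs ≡ length σ → j ∈ cs → 1 ≤ classComponents cs σ
  classComponents-positive cs σ {j} len≡ j∈ = ℕP.≤-trans (components-std-colourClass-positive cs σ len≡ j∈)
    (∈⇒≤sum-map (λ j → components (std (colourClass cs σ j))) (∈-allFin j))

  two-colours⇒classComponents-≥2 : ∀ (cs : List (Fin k)) σ {i j} → length cs ≡ length σ → i ∈ cs → j ∈ cs → ¬ i ≡ j →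
    2 ≤ classComponents cs σ
  two-colours⇒classComponents-≥2 cs σ {i} {j} len≡ i∈ j∈ i≢j = ℕP.≤-trans
    (ℕP.+-mono-≤ (components-std-colourClass-positive cs σ len≡ i∈) (components-std-colourClass-positive cs σ len≡ j∈))
    (∈-≢⇒+≤sum-map (λ j → components (std (colourClass cs σ j))) (UniqueP.allFin⁺ k) (∈-allFin i) (∈-allFin j) i≢j)

  classComponents≤1⇒monochrome : ∀ σ d (cs : List (Fin k)) → length (d ∷ cs) ≡ length σ →
    classComponents (d ∷ cs) σ ≤ 1 → d ∷ cs ≡ replicate (length σ) d
  classComponents≤1⇒monochrome σ d cs len≡ Φ≤1 =
    trans (All≡⇒replicate (refl ∷ All.tabulate same-colour)) (cong (λ m → replicate m d) len≡)
    where
      same-colour : ∀ {i} → i ∈ cs → i ≡ d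
      same-colour {i} i∈ with i FinP.≟ d
      ... | yes i≡d = i≡d
      ... | no i≢d = ⊥-elim (ℕP.<⇒≱ (two-colours⇒classComponents-≥2 (d ∷ cs) σ len≡ (there i∈) (here refl) i≢d) Φ≤1)

  split-colouring : ∀ σ τ (cs : List (Fin k)) → 1 ≤ length σ → length cs ≡ length (σ ⊞ τ) →
    ∃[ d ] ∃[ ds ] ∃[ es ] (cs ≡ (d ∷ ds) ++ es × length (d ∷ ds) ≡ length σ × length es ≡ length τ)
  split-colouring σ τ cs 1≤|σ| len≡ with split-++ (length σ) cs (trans len≡ (length-⊞ σ τ))
  ... | [] , _ , _ , |[]| , _ = ⊥-elim (ℕP.<⇒≱ 1≤|σ| (ℕP.≤-reflexive (sym |[]|)))
  ... | d ∷ ds , es , cs≡ , |d∷ds| , |es| = d , ds , es , cs≡ , |d∷ds| , |es|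

  classComponents-sumPerms-≥ : ∀ {σs} (cs : List (Fin k)) → All Indecomposable σs → length cs ≡ length (sumPerms σs) →
    length σs ≤ classComponents cs (sumPerms σs)
  classComponents-sumPerms-≥ {[]} _ _ _ = z≤n
  classComponents-sumPerms-≥ {σ ∷ σs} cs (σ-ind ∷ σs-ind) len≡
    with split-colouring σ (sumPerms σs) cs (proj₁ (proj₂ σ-ind)) len≡
  ... | d , ds , es , refl , |d∷ds| , |es| = begin
    suc (length σs)                                                      ≤⟨ ℕP.+-mono-≤ (classComponents-positive (d ∷ ds) σ |d∷ds| (here refl))
                                                                              (classComponents-sumPerms-≥ es σs-ind |es|) ⟩
    classComponents (d ∷ ds) σ + classComponents es (sumPerms σs)         ≡⟨ classComponents-⊞ σ _ (d ∷ ds) es (IsPerm⇒All≤ (proj₁ σ-ind))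
                                                                              (sumPerms-≥1 σs-ind) |d∷ds| ⟨
    classComponents ((d ∷ ds) ++ es) (sumPerms (σ ∷ σs))                  ∎
    where open ℕP.≤-Reasoning

  classComponents-sumPerms-≤⇒block : ∀ {σs} (cs : List (Fin k)) → All Indecomposable σs →
    length cs ≡ length (sumPerms σs) → classComponents cs (sumPerms σs) ≤ length σs →
    ∃[ ds ] (length ds ≡ length σs × cs ≡ blockColouring σs ds)
  classComponents-sumPerms-≤⇒block {[]} [] _ _ _ = [] , refl , refl
  classComponents-sumPerms-≤⇒block {σ ∷ σs} cs (σ-ind ∷ σs-ind) len≡ Φ≤
    with split-colouring σ (sumPerms σs) cs (proj₁ (proj₂ σ-ind)) len≡
  ... | d , ds , es , refl , |d∷ds| , |es| =
    let Φσ≤1 , Φes≤ = +-squeeze (subst (_≤ suc (length σs)) Φ≡ Φ≤)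
                        (classComponents-positive (d ∷ ds) σ |d∷ds| (here refl)) (classComponents-sumPerms-≥ es σs-ind |es|)
        es′ , |es′| , es≡ = classComponents-sumPerms-≤⇒block es σs-ind |es| Φes≤
    in d ∷ es′ , cong suc |es′| , cong₂ _++_ (classComponents≤1⇒monochrome σ d ds |d∷ds| Φσ≤1) es≡
    where
      Φ≡ : classComponents ((d ∷ ds) ++ es) (sumPerms (σ ∷ σs)) ≡ classComponents (d ∷ ds) σ + classComponents es (sumPerms σs)
      Φ≡ = classComponents-⊞ σ _ (d ∷ ds) es (IsPerm⇒All≤ (proj₁ σ-ind)) (sumPerms-≥1 σs-ind) |d∷ds|

-- Two-peg web diagrams

edges : List (ℕ × ℕ) → Diagram
edges = map (λ { (i , v) → (1 , 2 , i , v) })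

-- D_τ, also for τ that is not a permutation
diagram : List ℕ → Diagram
diagram τ = edges (zip (range 0 (length τ)) τ)

Dperm≡diagram : ∀ π → Dperm π ≡ diagram π
Dperm≡diagram π = cong (λ hs → edges (zip hs π)) (map-suc-upTo (length π))

length-Dperm : ∀ π → length (Dperm π) ≡ length π
length-Dperm π = trans (cong length (Dperm≡diagram π))
  (trans (ListP.length-map _ (zip (range 0 (length π)) π))
         (trans (length-zip (range 0 (length π)) π (length-range 0 (length π))) (length-range 0 (length π))))

pegCount₁-edges : ∀ ps → pegCount 1 (edges ps) ≡ length ps
pegCount₁-edges [] = refl
pegCount₁-edges (p ∷ ps) = cong suc (pegCount₁-edges ps)

pegCount₂-edges : ∀ ps → pegCount 2 (edges ps) ≡ length ps
pegCount₂-edges [] = refl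
pegCount₂-edges (p ∷ ps) = cong suc (pegCount₂-edges ps)

rank₁-edges : ∀ ps h → length (filter (λ e → (proj₁ e ℕP.≟ 1) ×-dec (proj₂ e <? h)) (endpoints (edges ps)))
  ≡ below (map proj₁ ps) h
rank₁-edges [] h = refl
-- the filter's test on the endpoint (1 , i) computes to i <ᵇ h
rank₁-edges ((i , v) ∷ ps) h with i <ᵇ h
... | true = cong suc (rank₁-edges ps h)
... | false = rank₁-edges ps h

rank₂-edges : ∀ ps h → length (filter (λ e → (proj₁ e ℕP.≟ 2) ×-dec (proj₂ e <? h)) (endpoints (edges ps)))
  ≡ below (map proj₂ ps) h
rank₂-edges [] h = refl
rank₂-edges ((i , v) ∷ ps) h with v <ᵇ h
... | true = cong suc (rank₂-edges ps h)
... | false = rank₂-edges ps h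

rel-edges : ∀ ps → rel (edges ps) ≡ edges (zip (std (map proj₁ ps)) (std (map proj₂ ps)))
rel-edges ps = trans (relabel ps) (cong₂ (λ hs vs → edges (zip hs vs))
  (ListP.map-cong (λ h → cong suc (rank₁-edges ps h)) (map proj₁ ps))
  (ListP.map-cong (λ v → cong suc (rank₂-edges ps v)) (map proj₂ ps)))
  where
    relabel : ∀ qs → map (λ { (a , b , c , d) → (a , b , rank a c (edges ps) , rank b d (edges ps)) }) (edges qs)
      ≡ edges (zip (map (λ h → rank 1 h (edges ps)) (map proj₁ qs)) (map (λ v → rank 2 v (edges ps)) (map proj₂ qs)))
    relabel [] = refl
    relabel (q ∷ qs) = cong (_ ∷_) (relabel qs)

diagram-⊕ : ∀ α β → diagram α ⊕ diagram β ≡ diagram (α ⊞ β)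
diagram-⊕ α β = sym (begin
  edges (zip (range 0 (length (α ⊞ β))) (α ++ map (a +_) β))
    ≡⟨ cong (λ hs → edges (zip hs (α ++ map (a +_) β))) (trans (cong (range 0) (length-⊞ α β)) (range-+ 0 a (length β))) ⟩
  edges (zip (range 0 a ++ range a (length β)) (α ++ map (a +_) β))
    ≡⟨ cong edges (zip-++ (range 0 a) (range a (length β)) α (map (a +_) β) (length-range 0 a)) ⟩
  edges (zip (range 0 a) α ++ zip (range a (length β)) (map (a +_) β))
    ≡⟨ ListP.map-++ _ (zip (range 0 a) α) _ ⟩
  diagram α ++ edges (zip (range a (length β)) (map (a +_) β))
    ≡⟨ cong (λ hs → diagram α ++ edges (zip hs (map (a +_) β))) (range-shift a (length β)) ⟩
  diagram α ++ edges (zip (map (a +_) (range 0 (length β))) (map (a +_) β))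
    ≡⟨ cong (diagram α ++_) (lift (range 0 (length β)) β) ⟨
  diagram α ⊕ diagram β ∎)
  where
    open ≡-Reasoning
    a : ℕ
    a = length α
    pegs : length (zip (range 0 a) α) ≡ a
    pegs = trans (length-zip (range 0 a) α (length-range 0 a)) (length-range 0 a)
    lift : ∀ hs vs → map (λ { (x , y , c , d) → (x , y , c + pegCount x (diagram α) , d + pegCount y (diagram α)) })
                         (edges (zip hs vs))
                   ≡ edges (zip (map (a +_) hs) (map (a +_) vs))
    lift [] vs = refl
    lift (h ∷ hs) [] = refl
    lift (h ∷ hs) (v ∷ vs) = cong₂ _∷_
      (cong₂ (λ c d → (1 , 2 , c , d))
        (trans (cong (h +_) (trans (pegCount₁-edges (zip (range 0 a) α)) pegs)) (ℕP.+-comm h a))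
        (trans (cong (v +_) (trans (pegCount₂-edges (zip (range 0 a) α)) pegs)) (ℕP.+-comm v a)))
      (lift hs vs)

foldl-⊕-diagram : ∀ α τs → foldl _⊕_ (diagram α) (map diagram τs) ≡ diagram (foldl _⊞_ α τs)
foldl-⊕-diagram α [] = refl
foldl-⊕-diagram α (τ ∷ τs) =
  trans (cong (λ D → foldl _⊕_ D (map diagram τs)) (diagram-⊕ α τ)) (foldl-⊕-diagram (α ⊞ τ) τs)

-- The peg-1 heights of a colour class are increasing, so rel turns them into 1, 2, …
rel-colourClass : ∀ {k} π (cs : List (Fin k)) j → rel (colourClass cs (diagram π) j) ≡ diagram (std (colourClass cs π j))
rel-colourClass π cs j = begin
  rel (colourClass cs (edges (zip hs π)) j)                                ≡⟨ cong rel (colourClass-map _ cs (zip hs π) j) ⟩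
  rel (edges ps)                                                           ≡⟨ rel-edges ps ⟩
  edges (zip (std (map proj₁ ps)) (std (map proj₂ ps)))                    ≡⟨ cong₂ (λ xs ys → edges (zip xs ys)) heights
                                                                                (cong std (colourClass-zip-proj₂ cs hs π j |hs|)) ⟩
  diagram (std (colourClass cs π j))                                       ∎
  where
    open ≡-Reasoning
    hs : List ℕ
    hs = range 0 (length π)
    |hs| : length hs ≡ length π
    |hs| = length-range 0 (length π)
    ps : List (ℕ × ℕ)
    ps = colourClass cs (zip hs π) j
    heights : std (map proj₁ ps) ≡ range 0 (length (std (colourClass cs π j)))
    heights = begin
      std (map proj₁ ps)                             ≡⟨ cong std (colourClass-zip-proj₁ cs hs π j |hs|) ⟩
      std (colourClass cs hs j)                      ≡⟨ std-increasing (colourClass-increasing cs j (range-increasing 0 (length π))) ⟩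
      range 0 (length (colourClass cs hs j))         ≡⟨ cong (range 0) (length-colourClass cs hs π j |hs|) ⟩
      range 0 (length (colourClass cs π j))          ≡⟨ cong (range 0) (length-std (colourClass cs π j)) ⟨
      range 0 (length (std (colourClass cs π j)))    ∎

reconstruct-Dperm : ∀ {k} π (c : Vec (Fin k) (length (Dperm π))) →
  reconstruct (Dperm π) c ≡ diagram (reconstructPerm (toList c) π)
reconstruct-Dperm {k} π c = begin
  foldl _⊕_ [] (map (λ j → rel (colourClass (toList c) (Dperm π) j)) (allFin k))
    ≡⟨ cong (foldl _⊕_ []) (ListP.map-cong (λ j → trans (cong (λ D → rel (colourClass (toList c) D j)) (Dperm≡diagram π))
                                                        (rel-colourClass π (toList c) j)) (allFin k)) ⟩
  foldl _⊕_ [] (map (λ j → diagram (std (colourClass (toList c) π j))) (allFin k))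
    ≡⟨ cong (foldl _⊕_ []) (ListP.map-∘ (allFin k)) ⟩
  foldl _⊕_ (diagram []) (map diagram (map (λ j → std (colourClass (toList c) π j)) (allFin k)))
    ≡⟨ foldl-⊕-diagram [] (map (λ j → std (colourClass (toList c) π j)) (allFin k)) ⟩
  diagram (reconstructPerm (toList c) π) ∎
  where open ≡-Reasoning

-- Distinct heights on peg 1 make the edge set of diagram τ determine τ.
SameDiagram-diagram⇒≡ : ∀ ρ π → SameDiagram (diagram ρ) (diagram π) → ρ ≡ π
SameDiagram-diagram⇒≡ ρ π (ρ⊆π , π⊆ρ) = from-height 0 ρ π ρ⊆π π⊆ρ
  where
    edgesFrom : ℕ → List ℕ → Diagram
    edgesFrom a τ = edges (zip (range a (length τ)) τ)

    height₁ : Edge → ℕ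
    height₁ (_ , _ , h , _) = h

    above : ∀ a τ {e} → e ∈ edgesFrom a τ → a < height₁ e
    above a (v ∷ τ) (here refl) = ℕP.n<1+n a
    above a (v ∷ τ) (there e∈) = ℕP.<-trans (ℕP.n<1+n a) (above (suc a) τ e∈)

    drop-lowest : ∀ a {v} σ τ → All (_∈ (1 , 2 , suc a , v) ∷ edgesFrom (suc a) τ) (edgesFrom (suc a) σ) →
      All (_∈ edgesFrom (suc a) τ) (edgesFrom (suc a) σ)
    drop-lowest a σ τ σ⊆ = All.tabulate (λ e∈ → step e∈ (All.lookup σ⊆ e∈))
      where
        step : ∀ {e} → e ∈ edgesFrom (suc a) σ → e ∈ _ ∷ edgesFrom (suc a) τ → e ∈ edgesFrom (suc a) τ
        step e∈σ (here refl) = ⊥-elim (ℕP.<-irrefl refl (above (suc a) σ e∈σ))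
        step _ (there e∈τ) = e∈τ

    from-height : ∀ a ρ π → All (_∈ edgesFrom a π) (edgesFrom a ρ) → All (_∈ edgesFrom a ρ) (edgesFrom a π) → ρ ≡ π
    from-height a [] [] _ _ = refl
    from-height a [] (_ ∷ _) _ (() ∷ _)
    from-height a (_ ∷ _) [] (() ∷ _) _
    from-height a (x ∷ ρ) (y ∷ π) (x∈ ∷ ρ⊆π) (_ ∷ π⊆ρ) =
      cong₂ _∷_ (lowest x∈) (from-height (suc a) ρ π (drop-lowest a ρ π ρ⊆π) (drop-lowest a π ρ π⊆ρ))
      where
        lowest : (1 , 2 , suc a , x) ∈ edgesFrom a (y ∷ π) → x ≡ y
        lowest (here refl) = refl
        lowest (there e∈) = ⊥-elim (ℕP.<-irrefl refl (above (suc a) π e∈))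

reflexive-SameDiagram : ∀ D → SameDiagram D D
reflexive-SameDiagram D = All.tabulate (λ e∈ → e∈) , All.tabulate (λ e∈ → e∈)

module _ {k} (π : List ℕ) (c : Vec (Fin k) (length (Dperm π))) where

  SameDiagram-reconstruct⇒ : SameDiagram (reconstruct (Dperm π) c) (Dperm π) → reconstructPerm (toList c) π ≡ π
  SameDiagram-reconstruct⇒ same =
    SameDiagram-diagram⇒≡ _ π (subst₂ SameDiagram (reconstruct-Dperm π c) (Dperm≡diagram π) same)

  SameDiagram-reconstruct⇐ : reconstructPerm (toList c) π ≡ π → SameDiagram (reconstruct (Dperm π) c) (Dperm π)
  SameDiagram-reconstruct⇐ eq = subst (λ D → SameDiagram D (Dperm π))
    (sym (trans (reconstruct-Dperm π c) (trans (cong diagram eq) (sym (Dperm≡diagram π)))))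
    (reflexive-SameDiagram (Dperm π))

Surjective⇒∈ : ∀ {m k} (c : Vec (Fin k) m) → Surjective c → ∀ j → j ∈ toList c
Surjective⇒∈ c surj j with surj j
... | i , refl = VecM.∈-toList⁺ (VecM.∈-lookup i c)

∈⇒Surjective : ∀ {m k} (c : Vec (Fin k) m) → (∀ j → j ∈ toList c) → Surjective c
∈⇒Surjective c ∈c j = let j∈c = VecM.∈-toList⁻ (∈c j) in VecAny.index j∈c , sym (VecAnyP.lookup-index j∈c)

toList-injective : ∀ {A : Set} {m} {xs ys : Vec A m} → toList xs ≡ toList ys → xs ≡ ys
toList-injective {xs = xs} {ys} eq = trans (sym (VecP.cast-is-id refl xs)) (VecP.toList-injective refl xs ys eq)

vecOf : ∀ {A : Set} {m} (xs : List A) → length xs ≡ m → Vec A m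
vecOf xs len≡ = cast len≡ (fromList xs)

toList-vecOf : ∀ {A : Set} {m} (xs : List A) (len≡ : length xs ≡ m) → toList (vecOf xs len≡) ≡ xs
toList-vecOf xs len≡ = trans (VecP.toList-cast len≡ (fromList xs)) (VecP.toList∘fromList xs)

-- Web colourings of D_π versus readings of the word σ₁ ⋯ σₘ

module _ {k : ℕ} {σs : List (List ℕ)} (σs-ind : All Indecomposable σs) where

  private
    π : List ℕ
    π = sumPerms σs

    nonempty : All (λ σ → 1 ≤ length σ) σs
    nonempty = All.map (proj₁ ∘ proj₂) σs-ind

    length-blockColouring-Dperm : ∀ (c : Vec (Fin k) (length σs)) → length (blockColouring σs (toList c)) ≡ length (Dperm π)
    length-blockColouring-Dperm c =
      trans (length-blockColouring σs (toList c) (VecP.length-toList c)) (sym (length-Dperm π))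

  WebColouring : Vec (Fin k) (length (Dperm π)) → Set
  WebColouring c = Surjective c × SameDiagram (reconstruct (Dperm π) c) (Dperm π)

  webColouring? : Decidable WebColouring
  webColouring? c = surjective? c ×-dec sameDiagram? (reconstruct (Dperm π) c) (Dperm π)

  WordColouring : Vec (Fin k) (length σs) → Set
  WordColouring c = Surjective c × readIn σs c ≡ σs

  wordColouring? : Decidable WordColouring
  wordColouring? c = surjective? c ×-dec ListP.≡-dec _≟L_ (readIn σs c) σs

  inflate : Vec (Fin k) (length σs) → Vec (Fin k) (length (Dperm π))
  inflate c = vecOf (blockColouring σs (toList c)) (length-blockColouring-Dperm c)

  toList-inflate : ∀ c → toList (inflate c) ≡ blockColouring σs (toList c)
  toList-inflate c = toList-vecOf (blockColouring σs (toList c)) (length-blockColouring-Dperm c)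

  inflate-injective : ∀ {c c′} → inflate c ≡ inflate c′ → c ≡ c′
  inflate-injective {c} {c′} eq = toList-injective
    (blockColouring-injective (toList c) (toList c′) nonempty (VecP.length-toList c) (VecP.length-toList c′)
      (trans (sym (toList-inflate c)) (trans (cong toList eq) (toList-inflate c′))))

  reconstructPerm-inflate : ∀ c → reconstructPerm (toList (inflate c)) π ≡ sumPerms (readIn σs c)
  reconstructPerm-inflate c = trans (cong (λ cs → reconstructPerm cs π) (toList-inflate c))
    (reconstructPerm-blockColouring (toList c) σs-ind (VecP.length-toList c))

  WordColouring⇒WebColouring : ∀ c → WordColouring c → WebColouring (inflate c)
  WordColouring⇒WebColouring c (surj , read≡) =
    ∈⇒Surjective (inflate c) (λ j → subst (j ∈_) (sym (toList-inflate c))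
      (∈-blockColouring⁺ (toList c) nonempty (VecP.length-toList c) (Surjective⇒∈ c surj j))) ,
    SameDiagram-reconstruct⇐ π (inflate c) (trans (reconstructPerm-inflate c) (cong sumPerms read≡))

  -- A web colouring reproducing D_π has exactly as many class components as π has blocks,
  -- which forces it to be constant on blocks.
  WebColouring⇒classComponents : ∀ c → WebColouring c → classComponents (toList c) π ≡ length σs
  WebColouring⇒classComponents c (_ , same) = begin
    classComponents (toList c) π                ≡⟨ components-reconstructPerm (toList c) π ⟨
    components (reconstructPerm (toList c) π)   ≡⟨ cong components (SameDiagram-reconstruct⇒ π c same) ⟩
    components π                                ≡⟨ components-sumPerms σs-ind ⟩
    length σs                                   ∎
    where open ≡-Reasoning

  WebColouring⇒inflate : ∀ c → WebColouring c → ∃[ c′ ] (inflate c′ ≡ c)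
  WebColouring⇒inflate c web
    with classComponents-sumPerms-≤⇒block (toList c) σs-ind (trans (VecP.length-toList c) (length-Dperm π))
           (ℕP.≤-reflexive (WebColouring⇒classComponents c web))
  ... | ds , |ds| , c≡ = vecOf ds |ds| , toList-injective (begin
      toList (inflate (vecOf ds |ds|))           ≡⟨ toList-inflate (vecOf ds |ds|) ⟩
      blockColouring σs (toList (vecOf ds |ds|)) ≡⟨ cong (blockColouring σs) (toList-vecOf ds |ds|) ⟩
      blockColouring σs ds                       ≡⟨ c≡ ⟨
      toList c                                   ∎)
    where open ≡-Reasoning

  WebColouring-inflate⇒WordColouring : ∀ c → WebColouring (inflate c) → WordColouring c
  WebColouring-inflate⇒WordColouring c (surj , same) =
    ∈⇒Surjective c (λ j → ∈-blockColouring⁻ σs (toList c) (subst (j ∈_) (toList-inflate c) (Surjective⇒∈ (inflate c) surj j))) ,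
    sumPerms-injective (readInList-All (toList c) σs-ind) σs-ind
      (trans (sym (reconstructPerm-inflate c)) (SameDiagram-reconstruct⇒ π (inflate c) same))

  WebColouring⇒WordColouring : ∀ c → WebColouring c → ∃[ c′ ] (inflate c′ ≡ c × WordColouring c′)
  WebColouring⇒WordColouring c web =
    let c′ , c′↦c = WebColouring⇒inflate c web
    in c′ , c′↦c , WebColouring-inflate⇒WordColouring c′ (subst WebColouring (sym c′↦c) web)

mainTheorem8 : (n : ℕ) → 1 ≤ n → (π : List ℕ) → IsPerm n π →
    (σs : List (List ℕ)) → All Indecomposable σs → sumPerms σs ≡ π →
    (k : ℕ) → webEntry (Dperm π) (Dperm π) k ≡ FWord _≟L_ σs k
mainTheorem8 _ _ _ _ σs σs-ind refl zero = refl
mainTheorem8 _ _ _ _ σs σs-ind refl (suc k) =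
  count-reindex (WebColouring σs-ind) (webColouring? σs-ind) (WordColouring σs-ind) (wordColouring? σs-ind)
    (inflate σs-ind) (inflate-injective σs-ind) (WordColouring⇒WebColouring σs-ind) (WebColouring⇒WordColouring σs-ind)
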